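{- Let $k\ge4$, $G$, $\mathcal S$, $\mathcal Q$ be as described in the context. Every $2$-star or $3$-star of $\mathcal S$ is associated with at most one special star of $\mathcal S$.
   Context: $G=(V,E)$ is a simple undirected graph, $k\ge4$ an integer. A star in $G$ is a subgraph that is a single vertex, a single edge, or a tree with exactly one vertex of degree $\ge2$ and all others of degree $1$; an $\ell$-star has exactly $\ell$ vertices, an $\ell^-$-star at most $\ell$, an $\ell^+$-star at least $\ell$. The center of a star is its vertex of maximum degree (in a $2$-star one vertex is designated as center, arbitrarily but fixed); the others are satellites. We write $v_1$-$v_2\ldots v_\ell$ for the star with center $v_1$ and satellites $v_2,\dots,v_\ell$. A $k^-$-star partition of $G$ is a collection of vertex-disjoint $k^-$-stars covering $V$. Operations on a partition $\mathcal S$ (critical vertices are vertices in a $2$-star of $\mathcal S$ or centers of $3$-stars of $\mathcal S$; separate critical vertices lie in different stars of $\mathcal S$): Op.1: for $\{u,v\}\in E$ with $u$ in a $2$-star and $v$ a satellite of a $4^+$-star centered at $c$, replace $\{c,v\}$ by $\{u,v\}$. Op.2: for a star $v_1$-$v_2\ldots v_\ell$ of $\mathcal S$ ($\ell\in\{2,3,4\}$) and pairwise separate critical vertices $w_1,\dots,w_\ell$ outside it with $\{v_j,w_j\}\in E$, replace its edges by $\{v_j,w_j\}$. Op.3: for a $2$- or $3$-star $S=v_1$-$v_2\ldots v_\ell$ and a $2$-star $W=w_1$-$w_2\neq S$ with $w_1,w_2$ adjacent to $v_1$: if $k\ge5$ or $\ell=2$ replace $\{w_1,w_2\}$ by $\{w_1,v_1\},\{w_2,v_1\}$;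 if $k=4,\ell=3$ and some critical $w_3\notin V(S)\cup V(W)$ is adjacent to $v_j$, $j\in\{2,3\}$, replace $\{w_1,w_2\},\{v_1,v_j\}$ by $\{w_1,v_1\},\{w_2,v_1\},\{w_3,v_j\}$. Standing assumptions: $\mathcal S$ is a $k^-$-star partition of $G$ with the minimum possible number of $1$-stars among all $k^-$-star partitions of $G$ and to which none of Operations 1–3 is applicable (equivalently, a possible output of the paper's algorithm). $\mathcal Q$ is a fixed optimal $k^-$-star partition (minimum number of stars), with a fixed center for each of its $2$-stars. A vertex is a center (satellite) of $\mathcal Q$ if it is the center (a satellite) of some star of $\mathcal Q$; an edge of $\mathcal Q$ is an edge of some star of $\mathcal Q$. Special stars: a $3$-star $S=v_1$-$v_2v_3$ of $\mathcal S$ is special if there is a $2$-star $W=w_1$-$w_2$ of $\mathcal S$ such that (C1) $v_1$ is a satellite of $\mathcal Q$ and $v_2,v_3$ are centers of $\mathcal Q$, and (C2) there are $v_i,v_j\in V(S)$ with $\{v_i,w_1\}$ and $\{v_j,w_2\}$ edges of $\mathcal Q$. A $2$-star $S=v_1$-$v_2$ of $\mathcal S$ is special if $v_1,v_2$ are both satellites of $\mathcal Q$ and either (C3) $k=4$ and there is a $3$-star of $\mathcal S$ with center $w$ such that $\{v_1,w\},\{v_2,w\}$ are edges of $\mathcal Q$, or (C4) there is a $2$-star $W=w_1$-$w_2$ of $\mathcal S$ with $\{v_1,w_1\},\{v_2,w_2\}$ edges of $\mathcal Q$. In these cases the star $W$ (in C1–C2 or C4) or the $3$-star (in C3) is said to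 be associated with $S$. -}

module Defs where

open import Data.Nat using (ℕ; zero; suc; _+_; _≤_)
open import Data.Fin using (Fin)
open import Data.List using (List; []; _∷_; length; concatMap)
open import Data.List.Membership.Propositional using (_∈_; _∉_)
open import Data.List.Relation.Unary.All using (All)
open import Data.List.Relation.Unary.AllPairs using (AllPairs)
open import Data.List.Relation.Unary.Unique.Propositional using (Unique)
open import Data.List.Relation.Binary.Pointwise using (Pointwise)
open import Data.Product using (Σ; ∃; ∃-syntax; _×_; _,_)
open import Data.Sum using (_⊎_)
open import Relation.Binary.PropositionalEquality using (_≡_; _≢_)
open import Relation.Nullary using (¬_)

record Graph (n : ℕ) : Set₁ where
  field
    E       : Fin n → Fin n → Set
    E-sym   : ∀ {x y} → E x y → E y x
    E-irrefl : ∀ {x} → ¬ E x x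
open Graph public

-- A star is given by its center and its list of satellites.
-- (For a 2-star the designated center is the field 'center'.)

record Star (n : ℕ) : Set where
  constructor _-★_
  field
    center : Fin n
    sats   : List (Fin n)
open Star public

verts : ∀ {n} → Star n → List (Fin n)
verts X = center X ∷ sats X

size : ∀ {n} → Star n → ℕ
size X = suc (length (sats X))

IsStarOf : ∀ {n} → Graph n → Star n → Set
IsStarOf G X = center X ∉ sats X × Unique (sats X) × All (E G (center X)) (sats X)

IsKPartition : ∀ {n} → Graph n → ℕ → List (Star n) → Set
IsKPartition {n} G k P =
  All (IsStarOf G) P × All (λ X → size X ≤ k) P ×
  Unique (concatMap verts P) × (∀ (v : Fin n) → v ∈ concatMap verts P)

num1 : ∀ {n} → List (Star n) → ℕ
num1 [] = 0
num1 ((c -★ []) ∷ P) = suc (num1 P)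
num1 ((c -★ (_ ∷ _)) ∷ P) = num1 P

MinOnes : ∀ {n} → Graph n → ℕ → List (Star n) → Set
MinOnes G k S = ∀ P → IsKPartition G k P → num1 S ≤ num1 P

Optimal : ∀ {n} → Graph n → ℕ → List (Star n) → Set
Optimal G k Q = ∀ P → IsKPartition G k P → length Q ≤ length P

Critical : ∀ {n} → List (Star n) → Fin n → Set
Critical S v = (∃[ X ] X ∈ S × size X ≡ 2 × v ∈ verts X)
             ⊎ (∃[ X ] X ∈ S × size X ≡ 3 × center X ≡ v)

Separate : ∀ {n} → List (Star n) → Fin n → Fin n → Set
Separate S x y = ∀ X → X ∈ S → x ∈ verts X → y ∉ verts X

Op1 : ∀ {n} → Graph n → List (Star n) → Set
Op1 G S = ∃[ u ] ∃[ v ] E G u v ×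
  (∃[ U ] U ∈ S × size U ≡ 2 × u ∈ verts U) ×
  (∃[ C ] C ∈ S × 4 ≤ size C × v ∈ sats C)

Op2 : ∀ {n} → Graph n → List (Star n) → Set
Op2 G S = ∃[ X ] X ∈ S × (size X ≡ 2 ⊎ size X ≡ 3 ⊎ size X ≡ 4) ×
  (∃[ ws ] Pointwise (E G) (verts X) ws × All (Critical S) ws ×
           All (λ w → w ∉ verts X) ws × AllPairs (Separate S) ws)

Op3 : ∀ {n} → Graph n → ℕ → List (Star n) → Set
Op3 G k S = ∃[ X ] X ∈ S × (size X ≡ 2 ⊎ size X ≡ 3) ×
  (∃[ W ] W ∈ S × W ≢ X × ∃[ w₂ ] sats W ≡ w₂ ∷ [] ×
     E G (center W) (center X) × E G w₂ (center X) ×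
     ((5 ≤ k ⊎ size X ≡ 2) ⊎
      (k ≡ 4 × size X ≡ 3 ×
        ∃[ vj ] vj ∈ sats X × ∃[ w₃ ] Critical S w₃ × w₃ ∉ verts X × w₃ ∉ verts W ×
          E G w₃ vj)))

CenterQ : ∀ {n} → List (Star n) → Fin n → Set
CenterQ Q v = ∃[ Y ] Y ∈ Q × center Y ≡ v

SatelliteQ : ∀ {n} → List (Star n) → Fin n → Set
SatelliteQ Q v = ∃[ Y ] Y ∈ Q × v ∈ sats Y

EdgeQ : ∀ {n} → List (Star n) → Fin n → Fin n → Set
EdgeQ Q x y = ∃[ Y ] Y ∈ Q × ((center Y ≡ x × y ∈ sats Y) ⊎ (center Y ≡ y × x ∈ sats Y))

-- Associated X S : the star X of S is associated with the special star S
-- (X witnesses that S is special). Both X and S are meant to be stars of 𝒮.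

Associated : ∀ {n} → ℕ → List (Star n) → Star n → Star n → Set
Associated k Q X S =
  -- S = v1-v2v3 special 3-star, X = w1-w2 a 2-star: (C1) and (C2)
  (∃[ v₂ ] ∃[ v₃ ] sats S ≡ v₂ ∷ v₃ ∷ [] × ∃[ w₂ ] sats X ≡ w₂ ∷ [] ×
     SatelliteQ Q (center S) × CenterQ Q v₂ × CenterQ Q v₃ ×
     (∃[ vi ] vi ∈ verts S × EdgeQ Q vi (center X)) ×
     (∃[ vj ] vj ∈ verts S × EdgeQ Q vj w₂))
  ⊎
  (∃[ v₂ ] sats S ≡ v₂ ∷ [] × SatelliteQ Q (center S) × SatelliteQ Q v₂ ×
     ( -- (C3): k = 4, X a 3-star with center w
       (k ≡ 4 × size X ≡ 3 × EdgeQ Q (center S) (center X) × EdgeQ Q v₂ (center X))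
     ⊎ -- (C4): X = w1-w2 a 2-star
       (∃[ w₂ ] sats X ≡ w₂ ∷ [] × EdgeQ Q (center S) (center X) × EdgeQ Q v₂ w₂)))

{-# OPTIONS --safe #-}
-- If two distinct vertices have Q-edges to w, then w is not a Q-satellite (its Q-edge would
-- go to its own centre only), so both are satellites of the Q-star centred at w. Suppose X is
-- associated with two different special stars S₁, S₂ of 𝒮.
-- • If S₁ = v₁-v₂v₃ is a special 3-star and X = w₁-w₂, then v₂, v₃ are Q-centres, so v₁ is a
--   satellite of the Q-stars centred at w₁ and at w₂, forcing w₁ = w₂.
-- • If both are 2-stars of type (C4), Operation 2 applies to X, pairing w₁ with the centre of
--   S₁ and w₂ with the satellite of S₂.
-- • If both are of type (C3), all four of their vertices are satellites of the Q-star centred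
--   at the centre of X, which has at most k = 4 vertices.
module Submission where

open import Defs
open import Data.Nat using (ℕ; _≤_; _<_; z≤n; s≤s)
open import Data.Nat.Properties using (≤-trans; <-irrefl)
open import Data.Fin using (Fin)
import Data.Fin.Properties as Fin
open import Data.List using (List; []; _∷_; _++_; length; concatMap)
open import Data.List.Properties using (≡-dec; length-++-sucʳ)
open import Data.List.Membership.Propositional using (_∈_; _∉_; lose)
open import Data.List.Membership.Propositional.Properties
  using (∈-++⁺ˡ; ∈-++⁺ʳ; ∈-++⁻; ∈-∃++; ∈-concatMap⁺)
open import Data.List.Relation.Binary.Subset.Propositional using (_⊆_)
open import Data.List.Relation.Binary.Disjoint.Propositional using (Disjoint)
open import Data.List.Relation.Unary.Any using (here; there)
open import Data.List.Relation.Unary.All as All using (All; []; _∷_)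
open import Data.List.Relation.Unary.All.Properties using (¬Any⇒All¬)
open import Data.List.Relation.Unary.AllPairs using ([]; _∷_)
open import Data.List.Relation.Unary.Unique.Propositional using (Unique)
import Data.List.Relation.Unary.Unique.Propositional.Properties as Unique
open import Data.List.Relation.Binary.Pointwise using ([]; _∷_)
open import Data.Product using (∃-syntax; _×_; _,_; proj₁; proj₂)
open import Data.Sum using (_⊎_; inj₁; inj₂)
open import Data.Empty using (⊥; ⊥-elim)
open import Function using (_∘_)
open import Relation.Binary.Definitions using (DecidableEquality)
open import Relation.Binary.PropositionalEquality using (_≡_; _≢_; refl; sym; trans; cong₂)
open import Relation.Nullary using (¬_; yes; no)
open import Relation.Nullary.Decidable using (map′; _×-dec_)

module _ {a} {A : Set a} where

  Unique-++⁻ʳ : ∀ xs {ys : List A} → Unique (xs ++ ys) → Unique ys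
  Unique-++⁻ʳ []       u       = u
  Unique-++⁻ʳ (x ∷ xs) (_ ∷ u) = Unique-++⁻ʳ xs u

  Unique-++⇒Disjoint : ∀ xs {ys : List A} → Unique (xs ++ ys) → Disjoint xs ys
  Unique-++⇒Disjoint (x ∷ xs) (x∉ ∷ _) (here refl , x∈ys) = All.lookup x∉ (∈-++⁺ʳ xs x∈ys) refl
  Unique-++⇒Disjoint (x ∷ xs) (_ ∷ u)  (there p , q)      = Unique-++⇒Disjoint xs u (p , q)

  Unique-⊆⇒length≤ : ∀ {xs ys : List A} → Unique xs → xs ⊆ ys → length xs ≤ length ys
  Unique-⊆⇒length≤ {[]}     _          _     = z≤n
  Unique-⊆⇒length≤ {x ∷ xs} (x∉xs ∷ u) xs⊆ys
    with ys₁ , ys₂ , refl ← ∈-∃++ (xs⊆ys (here refl))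
    rewrite length-++-sucʳ ys₁ x ys₂ = s≤s (Unique-⊆⇒length≤ u xs⊆ys₁++ys₂)
    where
    xs⊆ys₁++ys₂ : xs ⊆ ys₁ ++ ys₂
    xs⊆ys₁++ys₂ {y} y∈xs with ∈-++⁻ ys₁ (xs⊆ys (there y∈xs))
    ... | inj₁ p           = ∈-++⁺ˡ p
    ... | inj₂ (here refl) = ⊥-elim (All.lookup x∉xs y∈xs refl)
    ... | inj₂ (there p)   = ∈-++⁺ʳ ys₁ p

module _ {a b} {A : Set a} {B : Set b} {f : A → List B} where

  Unique-concatMap⇒shared⇒≡ : ∀ {xs x₁ x₂ y} → Unique (concatMap f xs) →
    x₁ ∈ xs → x₂ ∈ xs → y ∈ f x₁ → y ∈ f x₂ → x₁ ≡ x₂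
  Unique-concatMap⇒shared⇒≡ _ (here refl) (here refl) _ _ = refl
  Unique-concatMap⇒shared⇒≡ {x ∷ _} u (here refl) (there x₂∈) p q =
    ⊥-elim (Unique-++⇒Disjoint (f x) u (p , ∈-concatMap⁺ f (lose x₂∈ q)))
  Unique-concatMap⇒shared⇒≡ {x ∷ _} u (there x₁∈) (here refl) p q =
    ⊥-elim (Unique-++⇒Disjoint (f x) u (q , ∈-concatMap⁺ f (lose x₁∈ p)))
  Unique-concatMap⇒shared⇒≡ {x ∷ _} u (there x₁∈) (there x₂∈) p q =
    Unique-concatMap⇒shared⇒≡ (Unique-++⁻ʳ (f x) u) x₁∈ x₂∈ p q

_≟★_ : ∀ {n} → DecidableEquality (Star n)
(c -★ s) ≟★ (c′ -★ s′) =
  map′ (λ (p , q) → cong₂ _-★_ p q) (λ { refl → refl , refl })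
       ((c Fin.≟ c′) ×-dec (≡-dec Fin._≟_ s s′))

module _ {n : ℕ} where

  SatelliteOf : List (Star n) → Fin n → Fin n → Set
  SatelliteOf P w v = ∃[ Y ] Y ∈ P × center Y ≡ w × v ∈ sats Y

  Touches : List (Star n) → Star n → Fin n → Set
  Touches P T w = ∃[ v ] v ∈ verts T × EdgeQ P v w

  EdgeQ-sym : ∀ {P : List (Star n)} {x y} → EdgeQ P x y → EdgeQ P y x
  EdgeQ-sym (Y , Y∈ , inj₁ p) = Y , Y∈ , inj₂ p
  EdgeQ-sym (Y , Y∈ , inj₂ p) = Y , Y∈ , inj₁ p

  SatelliteOf⇒CenterQ : ∀ {P w v} → SatelliteOf P w v → CenterQ P w
  SatelliteOf⇒CenterQ (Y , Y∈ , c , _) = Y , Y∈ , c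

module StarPartition {n} {G : Graph n} {k} {P : List (Star n)} (P-part : IsKPartition G k P) where

  private
    stars : All (IsStarOf G) P
    stars = proj₁ P-part

    sizes : All (λ Y → size Y ≤ k) P
    sizes = proj₁ (proj₂ P-part)

    center∉sats-of : ∀ {Y} → Y ∈ P → center Y ∉ sats Y
    center∉sats-of Y∈ = proj₁ (All.lookup stars Y∈)

    sats-adjacent : ∀ {Y} → Y ∈ P → All (E G (center Y)) (sats Y)
    sats-adjacent Y∈ = proj₂ (proj₂ (All.lookup stars Y∈))

  shared-vertex⇒≡ : ∀ {Y₁ Y₂ x} → Y₁ ∈ P → Y₂ ∈ P → x ∈ verts Y₁ → x ∈ verts Y₂ → Y₁ ≡ Y₂
  shared-vertex⇒≡ = Unique-concatMap⇒shared⇒≡ (proj₁ (proj₂ (proj₂ P-part)))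

  ≢⇒Disjoint : ∀ {Y₁ Y₂} → Y₁ ∈ P → Y₂ ∈ P → Y₁ ≢ Y₂ → Disjoint (verts Y₁) (verts Y₂)
  ≢⇒Disjoint Y₁∈ Y₂∈ Y₁≢Y₂ (p , q) = Y₁≢Y₂ (shared-vertex⇒≡ Y₁∈ Y₂∈ p q)

  Unique-verts : ∀ {Y} → Y ∈ P → Unique (verts Y)
  Unique-verts {Y} Y∈ = ¬Any⇒All¬ (sats Y) (center∉sats-of Y∈) ∷ proj₁ (proj₂ (All.lookup stars Y∈))

  center≢sat : ∀ {Y v} → Y ∈ P → v ∈ sats Y → center Y ≢ v
  center≢sat Y∈ v∈ refl = center∉sats-of Y∈ v∈

  center∉sats : ∀ {Y₁ Y₂} → Y₁ ∈ P → Y₂ ∈ P → center Y₁ ∉ sats Y₂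
  center∉sats Y₁∈ Y₂∈ s with refl ← shared-vertex⇒≡ Y₁∈ Y₂∈ (here refl) (there s) = center∉sats-of Y₂∈ s

  EdgeQ-irrefl : ∀ {x} → ¬ EdgeQ P x x
  EdgeQ-irrefl (Y , Y∈ , inj₁ (refl , s)) = center∉sats-of Y∈ s
  EdgeQ-irrefl (Y , Y∈ , inj₂ (refl , s)) = center∉sats-of Y∈ s

  EdgeQ⇒E : ∀ {x y} → EdgeQ P x y → E G x y
  EdgeQ⇒E (Y , Y∈ , inj₁ (refl , s)) = All.lookup (sats-adjacent Y∈) s
  EdgeQ⇒E (Y , Y∈ , inj₂ (refl , s)) = E-sym G (All.lookup (sats-adjacent Y∈) s)

  CenterQ⇒¬SatelliteOf : ∀ {v w} → CenterQ P v → ¬ SatelliteOf P w v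
  CenterQ⇒¬SatelliteOf (Y₁ , Y₁∈ , refl) (Y₂ , Y₂∈ , _ , s) = center∉sats Y₁∈ Y₂∈ s

  SatelliteOf-functional : ∀ {v w w′} → SatelliteOf P w v → SatelliteOf P w′ v → w ≡ w′
  SatelliteOf-functional (Y₁ , Y₁∈ , refl , s₁) (Y₂ , Y₂∈ , refl , s₂)
    with refl ← shared-vertex⇒≡ Y₁∈ Y₂∈ (there s₁) (there s₂) = refl

  satellite-edge⇒SatelliteOf : ∀ {v w} → SatelliteQ P v → EdgeQ P v w → SatelliteOf P w v
  satellite-edge⇒SatelliteOf (Y₁ , Y₁∈ , s₁) (Y₂ , Y₂∈ , inj₁ (refl , _)) = ⊥-elim (center∉sats Y₂∈ Y₁∈ s₁)
  satellite-edge⇒SatelliteOf _               (Y₂ , Y₂∈ , inj₂ (c , s₂))   = Y₂ , Y₂∈ , c , s₂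

  common-neighbour⇒SatelliteOf : ∀ {v v′ w} → v ≢ v′ → EdgeQ P v w → EdgeQ P v′ w → SatelliteOf P w v
  common-neighbour⇒SatelliteOf v≢v′ (Y , Y∈ , inj₁ (c , w∈)) e′ =
    ⊥-elim (v≢v′ (SatelliteOf-functional (Y , Y∈ , c , w∈)
                    (satellite-edge⇒SatelliteOf (Y , Y∈ , w∈) (EdgeQ-sym e′))))
  common-neighbour⇒SatelliteOf _ (Y , Y∈ , inj₂ (c , v∈)) _ = Y , Y∈ , c , v∈

  common-Touches⇒SatelliteOf : ∀ {T₁ T₂ w} → Disjoint (verts T₁) (verts T₂) →
    Touches P T₁ w → Touches P T₂ w → ∃[ v ] v ∈ verts T₁ × SatelliteOf P w v
  common-Touches⇒SatelliteOf T₁#T₂ (v , v∈ , e) (v′ , v′∈ , e′) =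
    v , v∈ , common-neighbour⇒SatelliteOf (λ { refl → T₁#T₂ (v∈ , v′∈) }) e e′

  centers-sats⇒SatelliteOf-center : ∀ {T v w} → All (CenterQ P) (sats T) → v ∈ verts T →
    SatelliteOf P w v → SatelliteOf P w (center T)
  centers-sats⇒SatelliteOf-center _       (here refl) sat = sat
  centers-sats⇒SatelliteOf-center centers (there s)   sat =
    ⊥-elim (CenterQ⇒¬SatelliteOf (All.lookup centers s) sat)

  common-Touches⇒≡ : ∀ {T₁ T₂ w₁ w₂} → All (CenterQ P) (sats T₁) → Disjoint (verts T₁) (verts T₂) →
    Touches P T₁ w₁ → Touches P T₂ w₁ → Touches P T₁ w₂ → Touches P T₂ w₂ → w₁ ≡ w₂
  common-Touches⇒≡ centers T₁#T₂ t₁ t₁′ t₂ t₂′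
    with _ , v₁∈ , sat₁ ← common-Touches⇒SatelliteOf T₁#T₂ t₁ t₁′
       | _ , v₂∈ , sat₂ ← common-Touches⇒SatelliteOf T₁#T₂ t₂ t₂′
    = SatelliteOf-functional (centers-sats⇒SatelliteOf-center centers v₁∈ sat₁)
                             (centers-sats⇒SatelliteOf-center centers v₂∈ sat₂)

  satellites-bound : ∀ {w vs} → CenterQ P w → Unique vs → All (SatelliteOf P w) vs → length vs < k
  satellites-bound {vs = vs} (Y , Y∈ , refl) u sat =
    ≤-trans (s≤s (Unique-⊆⇒length≤ u vs⊆sats)) (All.lookup sizes Y∈)
    where
    vs⊆sats : vs ⊆ sats Y
    vs⊆sats v∈ with Y′ , Y′∈ , c , s ← All.lookup sat v∈
                  with refl ← shared-vertex⇒≡ Y′∈ Y∈ (here (sym c)) (here refl) = s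

-- The shapes of X and S sit in the indices, so incompatible pairs of cases die by unification.
data AssociatedView {n} (k : ℕ) (Q : List (Star n)) : Star n → Star n → Set where
  C1C2 : ∀ {w₁ w₂ v₁ v₂ v₃} → CenterQ Q v₂ → CenterQ Q v₃ →
         Touches Q (v₁ -★ (v₂ ∷ v₃ ∷ [])) w₁ → Touches Q (v₁ -★ (v₂ ∷ v₃ ∷ [])) w₂ →
         AssociatedView k Q (w₁ -★ (w₂ ∷ [])) (v₁ -★ (v₂ ∷ v₃ ∷ []))
  C3   : ∀ {X v₁ v₂} → k ≡ 4 → size X ≡ 3 →
         SatelliteOf Q (center X) v₁ → SatelliteOf Q (center X) v₂ →
         AssociatedView k Q X (v₁ -★ (v₂ ∷ []))
  C4   : ∀ {w₁ w₂ v₁ v₂} → EdgeQ Q v₁ w₁ → EdgeQ Q v₂ w₂ →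
         AssociatedView k Q (w₁ -★ (w₂ ∷ [])) (v₁ -★ (v₂ ∷ []))

touches : ∀ {n k Q} {w₁ w₂ : Fin n} {S} →
  AssociatedView k Q (w₁ -★ (w₂ ∷ [])) S → Touches Q S w₁ × Touches Q S w₂
touches (C1C2 _ _ t₁ t₂) = t₁ , t₂
touches (C4 e₁ e₂)       = (_ , here refl , e₁) , (_ , there (here refl) , e₂)
touches (C3 _ () _ _)

module _ {n} {G : Graph n} {k} {Q : List (Star n)} (Q-part : IsKPartition G k Q) where

  private
    module Qᴾ = StarPartition {G = G} {k = k} {P = Q} Q-part

  Associated⇒View : ∀ {X S} → Associated k Q X S → AssociatedView k Q X S
  Associated⇒View {X = _ -★ _} {S = _ -★ _} (inj₁ (_ , _ , refl , _ , refl , _ , c₂ , c₃ , t₁ , t₂)) =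
    C1C2 c₂ c₃ t₁ t₂
  Associated⇒View {S = _ -★ _} (inj₂ (_ , refl , s₁ , s₂ , inj₁ (k≡4 , size≡3 , e₁ , e₂))) =
    C3 k≡4 size≡3 (Qᴾ.satellite-edge⇒SatelliteOf s₁ e₁) (Qᴾ.satellite-edge⇒SatelliteOf s₂ e₂)
  Associated⇒View {X = _ -★ _} {S = _ -★ _} (inj₂ (_ , refl , _ , _ , inj₂ (_ , refl , e₁ , e₂))) =
    C4 e₁ e₂

module _ {n} {G : Graph n} {k} {𝒮 Q : List (Star n)}
         (𝒮-part : IsKPartition G k 𝒮) (Q-part : IsKPartition G k Q) where

  private
    module 𝒮ᴾ = StarPartition {G = G} {k = k} {P = 𝒮} 𝒮-part
    module Qᴾ = StarPartition {G = G} {k = k} {P = Q} Q-part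

  C4-pair⇒Op2 : ∀ {w₁ w₂ v₁ v₂ v₁′ v₂′} →
    (w₁ -★ (w₂ ∷ [])) ∈ 𝒮 → (v₁ -★ (v₂ ∷ [])) ∈ 𝒮 → (v₁′ -★ (v₂′ ∷ [])) ∈ 𝒮 →
    (v₁ -★ (v₂ ∷ [])) ≢ (v₁′ -★ (v₂′ ∷ [])) → EdgeQ Q v₁ w₁ → EdgeQ Q v₂′ w₂ → Op2 G 𝒮
  C4-pair⇒Op2 {w₁} {w₂} {v₁} {v₂} {v₁′} {v₂′} X∈ S₁∈ S₂∈ S₁≢S₂ e₁ e₂ =
    _ , X∈ , inj₁ refl , _ ,
    (E-sym G (Qᴾ.EdgeQ⇒E e₁) ∷ E-sym G (Qᴾ.EdgeQ⇒E e₂) ∷ []) ,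
    (inj₁ (_ , S₁∈ , refl , here refl) ∷ inj₁ (_ , S₂∈ , refl , there (here refl)) ∷ []) ,
    (v₁∉X ∷ v₂′∉X ∷ []) , ((separate ∷ []) ∷ [] ∷ [])
    where
    v₁∉X : v₁ ∉ w₁ ∷ w₂ ∷ []
    v₁∉X v₁∈X with refl ← 𝒮ᴾ.shared-vertex⇒≡ S₁∈ X∈ (here refl) v₁∈X = Qᴾ.EdgeQ-irrefl e₁

    v₂′∉X : v₂′ ∉ w₁ ∷ w₂ ∷ []
    v₂′∉X v₂′∈X with refl ← 𝒮ᴾ.shared-vertex⇒≡ S₂∈ X∈ (there (here refl)) v₂′∈X = Qᴾ.EdgeQ-irrefl e₂

    separate : Separate 𝒮 v₁ v₂′
    separate Z Z∈ v₁∈Z v₂′∈Z =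
      S₁≢S₂ (trans (𝒮ᴾ.shared-vertex⇒≡ S₁∈ Z∈ (here refl) v₁∈Z)
                   (𝒮ᴾ.shared-vertex⇒≡ Z∈ S₂∈ v₂′∈Z (there (here refl))))

  AssociatedView-unique : ¬ Op2 G 𝒮 → ∀ {X S₁ S₂} → X ∈ 𝒮 → S₁ ∈ 𝒮 → S₂ ∈ 𝒮 → S₁ ≢ S₂ →
    AssociatedView k Q X S₁ → AssociatedView k Q X S₂ → ⊥
  AssociatedView-unique _ X∈ S₁∈ S₂∈ S₁≢S₂ (C1C2 c₂ c₃ t₁ t₂) a₂ with t₁′ , t₂′ ← touches a₂ =
    𝒮ᴾ.center≢sat X∈ (here refl)
      (Qᴾ.common-Touches⇒≡ (c₂ ∷ c₃ ∷ []) (𝒮ᴾ.≢⇒Disjoint S₁∈ S₂∈ S₁≢S₂) t₁ t₁′ t₂ t₂′)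
  AssociatedView-unique _ X∈ S₁∈ S₂∈ S₁≢S₂ a₁ (C1C2 c₂ c₃ t₂ t₂′) with t₁ , t₁′ ← touches a₁ =
    𝒮ᴾ.center≢sat X∈ (here refl)
      (Qᴾ.common-Touches⇒≡ (c₂ ∷ c₃ ∷ []) (𝒮ᴾ.≢⇒Disjoint S₂∈ S₁∈ (S₁≢S₂ ∘ sym)) t₂ t₁ t₂′ t₁′)
  AssociatedView-unique ¬op2 X∈ S₁∈ S₂∈ S₁≢S₂ (C4 e₁ _) (C4 _ e₂) =
    ¬op2 (C4-pair⇒Op2 X∈ S₁∈ S₂∈ S₁≢S₂ e₁ e₂)
  AssociatedView-unique _ _ S₁∈ S₂∈ S₁≢S₂ (C3 k≡4 _ s₁ s₂) (C3 _ _ s₁′ s₂′) =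
    <-irrefl (sym k≡4)
      (Qᴾ.satellites-bound (SatelliteOf⇒CenterQ s₁)
        (Unique.++⁺ (𝒮ᴾ.Unique-verts S₁∈) (𝒮ᴾ.Unique-verts S₂∈) (𝒮ᴾ.≢⇒Disjoint S₁∈ S₂∈ S₁≢S₂))
        (s₁ ∷ s₂ ∷ s₁′ ∷ s₂′ ∷ []))
  AssociatedView-unique _ _ _ _ _ (C3 _ () _ _) (C4 _ _)
  AssociatedView-unique _ _ _ _ _ (C4 _ _) (C3 _ () _ _)

lemma8 : ∀ {n} (G : Graph n) (k : ℕ) → 4 ≤ k →
    (𝒮 Q : List (Star n)) →
    IsKPartition G k 𝒮 → MinOnes G k 𝒮 →
    ¬ Op1 G 𝒮 → ¬ Op2 G 𝒮 → ¬ Op3 G k 𝒮 →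
    IsKPartition G k Q → Optimal G k Q →
    ∀ X → X ∈ 𝒮 → (size X ≡ 2 ⊎ size X ≡ 3) →
    ∀ S₁ S₂ → S₁ ∈ 𝒮 → S₂ ∈ 𝒮 →
    Associated k Q X S₁ → Associated k Q X S₂ → S₁ ≡ S₂
-- Beyond the partition properties of 𝒮 and Q, only the inapplicability of Operation 2 is used.
lemma8 G _ _ _ _ 𝒮-part _ _ ¬op2 _ Q-part _ _ X∈ _ S₁ S₂ S₁∈ S₂∈ a₁ a₂ with S₁ ≟★ S₂
... | yes S₁≡S₂ = S₁≡S₂
... | no  S₁≢S₂ =
  ⊥-elim (AssociatedView-unique {G = G} 𝒮-part Q-part ¬op2 X∈ S₁∈ S₂∈ S₁≢S₂
            (Associated⇒View {G = G} Q-part a₁) (Associated⇒View {G = G} Q-part a₂))
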